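{- A tight $\mathrm{CDCCD}(61,4,366)$ exists.
   Context: A circular double change covering design $\mathrm{CDCCD}(v,k,b)$ (strength 2) is a $v$-set $V$ with an ordered list $(B_1,\dots,B_b)$ of $k$-subsets of $V$ (blocks) such that every 2-subset of $V$ lies in at least one block, $|B_i\setminus B_{i+1}|=|B_{i+1}\setminus B_i|=2$ for $1\le i<b$, and $|B_b\setminus B_1|=|B_1\setminus B_b|=2$. Let $g_2(v,k)=\lceil\binom v2/(2k-3)\rceil$. A CDCCD is economical if $b=g_2(v,k)$, and tight if it is economical and $\binom v2/(2k-3)$ is an integer. -}

module Defs where

open import Data.Nat using (ℕ; zero; suc; _+_; _*_; _∸_)
open import Data.Nat.DivMod using (_/_)
open import Data.Nat.Divisibility using (_∣_)
open import Data.Nat.Combinatorics using (_C_)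
open import Data.Fin using (Fin; zero; suc)
open import Data.Fin.Subset using (Subset; _∈_; ∣_∣; _─_)
open import Data.Product using (Σ; ∃; _×_; _,_)
open import Relation.Binary.PropositionalEquality using (_≡_; _≢_)

-- Cyclic successor on Fin n: i ↦ i+1, and the last index ↦ 0.
-- Implements the consecutive pairs (B_i, B_{i+1}) for i < b and (B_b, B_1).
next : ∀ {n} → Fin n → Fin n
next {suc zero} zero = zero
next {suc (suc n)} zero = suc zero
next {suc (suc n)} (suc i) with next {suc n} i
... | zero = zero
... | suc j = suc (suc j)

-- g₂(v,k) = ⌈ C(v,2) / (2k-3) ⌉ (for k ≥ 2), ceiling computed as (a + d - 1) / d
-- with d = 2k-3 written as suc (2k-4) so the divisor is syntactically nonzero.
g₂ : (v k : ℕ) → ℕ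
g₂ v k = (v C 2 + (2 * k ∸ 3) ∸ 1) / suc (2 * k ∸ 4)

-- A CDCCD(v,k,b): point set Fin v, ordered blocks B : Fin b → Subset v
-- (index i : Fin b stands for block B_{i+1}).
record IsCDCCD (v k b : ℕ) (B : Fin b → Subset v) : Set where
  field
    blockSize : ∀ i → ∣ B i ∣ ≡ k
    covers    : ∀ (x y : Fin v) → x ≢ y → ∃ λ i → (x ∈ B i) × (y ∈ B i)
    changeOut : ∀ i → ∣ B i ─ B (next i) ∣ ≡ 2
    changeIn  : ∀ i → ∣ B (next i) ─ B i ∣ ≡ 2

IsTightCDCCD : (v k b : ℕ) → (Fin b → Subset v) → Set
IsTightCDCCD v k b B = IsCDCCD v k b B × (b ≡ g₂ v k) × ((2 * k ∸ 3) ∣ (v C 2))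

module Submission where

-- The 366 blocks are the 61 translates of six base blocks D₀, …, D₅ of ℤ₆₁, listed as
-- D₀, …, D₅, D₀ + 1, …, D₅ + 1, … . Every residue occurs as a difference inside one base
-- block, so every pair {x, y} lies in a translate of that block; block sizes and the
-- double changes between neighbours are checked by evaluation. Tightness is the
-- count 366 · (2·4 − 3) = 1830 = C(61, 2).

open import Defs
open import Algebra.Properties.CommutativeSemigroup using (xy∙z≈xz∙y)
open import Data.Bool using (Bool)
open import Data.Fin using (Fin; zero; suc; toℕ; combine; remQuot)
open import Data.Fin.Properties using (all?; any?; remQuot-combine; toℕ-fromℕ<; toℕ<n)
open import Data.Fin.Subset using (Subset; _∈_; ∣_∣; _─_)
open import Data.List using (List; []; _∷_)
open import Data.List.Membership.Propositional using (find; lose) renaming (_∈_ to _∈ₗ_)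
import Data.List.Membership.DecPropositional
open import Data.List.Relation.Unary.Any using (Any) renaming (any? to anyₗ?)
open import Data.Nat using (ℕ; zero; suc; _+_; _*_; _∸_; _%_; _≤_; NonZero)
open import Data.Nat.DivMod using (_mod_; m%n<n; m%n%n≡m%n; %-distribˡ-+; [m+n]%n≡m%n; m<n⇒m%n≡m)
open import Data.Nat.Divisibility using (divides)
open import Data.Nat.Properties
  using (_≟_; +-commutativeSemigroup; +-comm; +-identityʳ; +-suc; m+[n∸m]≡n; ≤-trans; m≤n+m; <⇒≤)
open import Data.Product using (∃; _×_; _,_; uncurry)
open import Data.Unit using (tt)
open import Data.Vec using (Vec; []; _∷_; lookup)
open import Data.Vec.Properties using (lookup⇒[]=)
open import Relation.Binary.PropositionalEquality using (_≡_; refl; sym; trans; cong; subst; module ≡-Reasoning)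
open import Relation.Nullary.Decidable using (does; dec-true; toWitness)

open Data.List.Membership.DecPropositional _≟_ using () renaming (_∈?_ to _∈ₗ?_)

-- Counting up in ℕ instead of using tabulate avoids the unary toℕ, which would make
-- the decision procedures for the concrete design several times slower.
indicatorFrom : ℕ → ∀ m → (ℕ → Bool) → Vec Bool m
indicatorFrom x zero    p = []
indicatorFrom x (suc m) p = p x ∷ indicatorFrom (suc x) m p

lookup-indicatorFrom : ∀ {p m} x (i : Fin m) → lookup (indicatorFrom x m p) i ≡ p (x + toℕ i)
lookup-indicatorFrom {p} x zero    = cong p (sym (+-identityʳ x))
lookup-indicatorFrom {p} x (suc i) =
  trans (lookup-indicatorFrom (suc x) i) (cong p (sym (+-suc x (toℕ i))))

module _ {n : ℕ} .{{_ : NonZero n}} where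
  open ≡-Reasoning

  [m%n+o]%n≡[m+o]%n : ∀ a b → (a % n + b) % n ≡ (a + b) % n
  [m%n+o]%n≡[m+o]%n a b = begin
    (a % n + b) % n          ≡⟨ %-distribˡ-+ (a % n) b n ⟩
    (a % n % n + b % n) % n  ≡⟨ cong (λ c → (c + b % n) % n) (m%n%n≡m%n a n) ⟩
    (a % n + b % n) % n      ≡⟨ %-distribˡ-+ a b n ⟨
    (a + b) % n              ∎

  [m+o%n]%n≡[m+o]%n : ∀ a b → (a + b % n) % n ≡ (a + b) % n
  [m+o%n]%n≡[m+o]%n a b = begin
    (a + b % n) % n  ≡⟨ cong (_% n) (+-comm a (b % n)) ⟩
    (b % n + a) % n  ≡⟨ [m%n+o]%n≡[m+o]%n b a ⟩
    (b + a) % n      ≡⟨ cong (_% n) (+-comm b a) ⟩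
    (a + b) % n      ∎

  -- The residue of y − x; adding n first keeps the truncated subtraction exact for x ≤ n.
  offset : ℕ → ℕ → Fin n
  offset x y = (y + n ∸ x) mod n

  +-offset : ∀ {x} y → x ≤ n → (x + toℕ (offset x y)) % n ≡ y % n
  +-offset {x} y x≤n = begin
    (x + toℕ (offset x y)) % n  ≡⟨ cong (λ c → (x + c) % n) (toℕ-fromℕ< (m%n<n (y + n ∸ x) n)) ⟩
    (x + (y + n ∸ x) % n) % n   ≡⟨ [m+o%n]%n≡[m+o]%n x (y + n ∸ x) ⟩
    (x + (y + n ∸ x)) % n       ≡⟨ cong (_% n) (m+[n∸m]≡n (≤-trans x≤n (m≤n+m n y))) ⟩
    (y + n) % n                 ≡⟨ [m+n]%n≡m%n y n ⟩
    y % n                       ∎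

  +-offset-% : ∀ u y → (u + toℕ (offset (u % n) y)) % n ≡ y % n
  +-offset-% u y = trans (sym ([m%n+o]%n≡[m+o]%n u _)) (+-offset y (<⇒≤ (m%n<n u n)))

  +-offset-offset : ∀ u {x} y → x ≤ n →
                    ((u + toℕ (offset x y)) % n + toℕ (offset (u % n) x)) % n ≡ y % n
  +-offset-offset u {x} y x≤n = begin
    ((u + d) % n + s) % n  ≡⟨ [m%n+o]%n≡[m+o]%n (u + d) s ⟩
    (u + d + s) % n        ≡⟨ cong (_% n) (xy∙z≈xz∙y +-commutativeSemigroup u d s) ⟩
    (u + s + d) % n        ≡⟨ [m%n+o]%n≡[m+o]%n (u + s) d ⟨
    ((u + s) % n + d) % n  ≡⟨ cong (λ c → (c + d) % n) (+-offset-% u x) ⟩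
    (x % n + d) % n        ≡⟨ [m%n+o]%n≡[m+o]%n x d ⟩
    (x + d) % n            ≡⟨ +-offset y x≤n ⟩
    y % n                  ∎
    where
      d = toℕ (offset x y)
      s = toℕ (offset (u % n) x)

  translate : ℕ → List ℕ → Subset n
  translate t D = indicatorFrom 0 n λ x → does (anyₗ? (λ u → (u + t) % n ≟ x) D)

  ∈-translate : ∀ {t D u} → u ∈ₗ D → (x : Fin n) → (u + t) % n ≡ toℕ x → x ∈ translate t D
  ∈-translate {t} {D} u∈D x u+t≡x = lookup⇒[]= x (translate t D) (begin
    _  ≡⟨ lookup-indicatorFrom 0 x ⟩
    _  ≡⟨ dec-true (anyₗ? (λ u → (u + t) % n ≟ toℕ x) D) (lose u∈D u+t≡x) ⟩
    _  ∎)

  -- Block t · k + l is the translate D l + t.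
  development : ∀ {k} → (Fin k → List ℕ) → Fin (n * k) → Subset n
  development {k} D i = uncurry (λ t l → translate (toℕ t) (D l)) (remQuot {n} k i)

  development-combine : ∀ {k} (D : Fin k → List ℕ) (t : Fin n) (l : Fin k) →
                        development D (combine t l) ≡ translate (toℕ t) (D l)
  development-combine {k} D t l =
    cong (uncurry (λ t l → translate (toℕ t) (D l))) (remQuot-combine {n} {k} t l)

  RealisesAllDifferences : ∀ {k} → (Fin k → List ℕ) → Set
  RealisesAllDifferences D = ∀ (d : Fin n) → ∃ λ l → Any (λ u → (u + toℕ d) % n ∈ₗ D l) (D l)

  development-covers : ∀ {k} {D : Fin k → List ℕ} → RealisesAllDifferences D →
                       ∀ (x y : Fin n) → ∃ λ i → x ∈ development D i × y ∈ development D i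
  development-covers {D = D} realises x y
    with l , u+d∈D ← realises (offset (toℕ x) (toℕ y))
    with u , u∈D , w∈D ← find u+d∈D
    = combine t l , in-block (∈-translate u∈D x u+t≡x) , in-block (∈-translate w∈D y w+t≡y)
    where
      t = offset (u % n) (toℕ x)
      in-block : ∀ {z} → z ∈ translate (toℕ t) (D l) → z ∈ development D (combine t l)
      in-block = subst (_ ∈_) (sym (development-combine D t l))
      u+t≡x : (u + toℕ t) % n ≡ toℕ x
      u+t≡x = trans (+-offset-% u (toℕ x)) (m<n⇒m%n≡m (toℕ<n x))
      w+t≡y : ((u + toℕ (offset (toℕ x) (toℕ y))) % n + toℕ t) % n ≡ toℕ y
      w+t≡y = trans (+-offset-offset u (toℕ y) (<⇒≤ (toℕ<n x))) (m<n⇒m%n≡m (toℕ<n y))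

baseBlock : Fin 6 → List ℕ
baseBlock zero                                = 0 ∷ 1 ∷ 4 ∷ 11 ∷ []
baseBlock (suc zero)                          = 4 ∷ 11 ∷ 16 ∷ 47 ∷ []
baseBlock (suc (suc zero))                    = 2 ∷ 4 ∷ 23 ∷ 47 ∷ []
baseBlock (suc (suc (suc zero)))              = 4 ∷ 23 ∷ 51 ∷ 57 ∷ []
baseBlock (suc (suc (suc (suc zero))))        = 5 ∷ 34 ∷ 51 ∷ 57 ∷ []
baseBlock (suc (suc (suc (suc (suc zero))))) = 5 ∷ 12 ∷ 25 ∷ 51 ∷ []

block : Fin 366 → Subset 61
block = development baseBlock

baseBlock-realisesAllDifferences : RealisesAllDifferences {61} baseBlock
baseBlock-realisesAllDifferences = toWitness {a? = all? λ d → any? λ l →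
  anyₗ? (λ u → (u + toℕ d) % 61 ∈ₗ? baseBlock l) (baseBlock l)} tt

block-size : ∀ i → ∣ block i ∣ ≡ 4
block-size = toWitness {a? = all? λ i → ∣ block i ∣ ≟ 4} tt

block-changeOut : ∀ i → ∣ block i ─ block (next i) ∣ ≡ 2
block-changeOut = toWitness {a? = all? λ i → ∣ block i ─ block (next i) ∣ ≟ 2} tt

block-changeIn : ∀ i → ∣ block (next i) ─ block i ∣ ≡ 2
block-changeIn = toWitness {a? = all? λ i → ∣ block (next i) ─ block i ∣ ≟ 2} tt

isCDCCD : IsCDCCD 61 4 366 block
isCDCCD = record
  { blockSize = block-size
  ; covers    = λ x y _ → development-covers baseBlock-realisesAllDifferences x y
  ; changeOut = block-changeOut
  ; changeIn  = block-changeIn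
  }

mainTheorem8 : ∃ λ (B : Fin 366 → Subset 61) → IsTightCDCCD 61 4 366 B
mainTheorem8 = block , isCDCCD , refl , divides 366 refl
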